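{- Let $G$ be the amalgamation of graphs $G_1$ and $G_2$ over $G_0=G_1\cap G_2$, and fix which player moves first. If Staller has a winning strategy in the Maker-Breaker total domination game on $G_1$ such that, for every possible sequence of moves, she isolates a vertex of $G_1\setminus G_2$, then Staller also has a winning strategy in the Maker-Breaker total domination game on $G$ (with the same player moving first).
   Context: The Maker-Breaker total domination game on a graph is played by Dominator and Staller, who alternately select a vertex not selected before. Dominator wins if at some point the set of vertices he has selected is a total dominating set (every vertex has a neighbour in it); otherwise Staller wins. Staller isolates a vertex $v$ if she selects all neighbours of $v$. Given disjoint graphs $G_1,G_2$ with isomorphic subgraphs $G_1'\subseteq G_1$, $H_2'\subseteq G_2$, the amalgamation of $G_1$ and $G_2$ over $G_1'=H_2'$ is obtained from their disjoint union by identifying $G_1'$ with $H_2'$ via a fixed isomorphism; the identified subgraph is denoted $G_0=G_1\cap G_2$. -}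

module Defs where

open import Level using (0ℓ)
open import Data.Nat using (ℕ)
open import Data.Fin using (Fin)
open import Data.Fin.Subset using (Subset; _∈_; _∉_; _∪_; ⁅_⁆; ⊥)
open import Data.Product using (Σ; ∃; ∃-syntax; _×_; _,_)
open import Data.Sum using (_⊎_)
open import Relation.Nullary using (¬_)
open import Relation.Binary.PropositionalEquality using (_≡_)
open import Function.Bundles using (_⇔_)
open import Function.Definitions using (Injective)

record Graph (n : ℕ) : Set₁ where
  field
    Adj    : Fin n → Fin n → Set
    sym    : ∀ {x y} → Adj x y → Adj y x
    irrefl : ∀ {x} → ¬ Adj x x
open Graph public

-- The vertices of G₀ = G₁ ∩ G₂ are those lying in both images.
record Amalgamation {n n₁ n₂ : ℕ} (G : Graph n) (G₁ : Graph n₁) (G₂ : Graph n₂) : Set where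
  field
    ι₁     : Fin n₁ → Fin n
    ι₂     : Fin n₂ → Fin n
    ι₁-inj : Injective _≡_ _≡_ ι₁
    ι₂-inj : Injective _≡_ _≡_ ι₂
    cover  : ∀ x → (∃[ a ] ι₁ a ≡ x) ⊎ (∃[ b ] ι₂ b ≡ x)
    adj    : ∀ x y →
             Adj G x y ⇔
               ((∃[ a ] ∃[ b ] (ι₁ a ≡ x × ι₁ b ≡ y × Adj G₁ a b))
                ⊎ (∃[ a ] ∃[ b ] (ι₂ a ≡ x × ι₂ b ≡ y × Adj G₂ a b)))

  OnlyInG₁ : Fin n₁ → Set
  OnlyInG₁ a = ¬ (∃[ b ] ι₂ b ≡ ι₁ a)
open Amalgamation public

data Player : Set where
  dominator staller : Player

-- StallerForces P p D S : in the position where Dominator has selected D,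
-- Staller has selected S and player p is to move, Staller has a strategy
-- such that every play (continued until all vertices are selected) ends in
-- a final position (D' , S') satisfying P.
data StallerForces {n : ℕ} (P : Subset n → Subset n → Set)
       : Player → Subset n → Subset n → Set where
  done    : ∀ {p D S} → (∀ v → v ∈ D ⊎ v ∈ S) → P D S → StallerForces P p D S
  sMove   : ∀ {D S} (v : Fin n) → v ∉ D → v ∉ S →
            StallerForces P dominator D (S ∪ ⁅ v ⁆) →
            StallerForces P staller D S
  dMove   : ∀ {D S} → (∃[ v ] (v ∉ D × v ∉ S)) →
            (∀ v → v ∉ D → v ∉ S → StallerForces P staller (D ∪ ⁅ v ⁆) S) →
            StallerForces P dominator D S

IsTotalDominating : ∀ {n} → Graph n → Subset n → Set
IsTotalDominating G D = ∀ v → ∃[ u ] (Adj G v u × u ∈ D)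

StallerWins : ∀ {n} → Graph n → Player → Set
StallerWins G p = StallerForces (λ D S → ¬ IsTotalDominating G D) p ⊥ ⊥

Isolates : ∀ {n} → Graph n → Subset n → Fin n → Set
Isolates G S v = ∀ u → Adj G v u → u ∈ S

-- Staller plays her G₁-strategy inside G. Whenever Dominator selects a copy of
-- a G₁-vertex she feeds that move to the strategy and answers with the copy of
-- its reply; moves outside G₁, and turns on which the simulated game has
-- nothing to play, are answered arbitrarily. Throughout, Dominator's vertices in
-- G₁ are exactly those he took in the simulated game, so the vertex of G₁ ∖ G₂
-- that the strategy isolates has no neighbour chosen by Dominator in G: all its
-- neighbours in G lie in G₁, because it is not a vertex of G₂.
module Submission where

open import Defs
open import Data.Nat using (ℕ)
open import Data.Fin using (Fin)
open import Data.Fin.Properties using (any?; _≟_)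
open import Data.Fin.Subset using (Subset; _∈_; _∉_; _∪_; ⁅_⁆; ⊥; _⊆_; _⊂_; _⊃_)
open import Data.Fin.Subset.Properties
  using (_∈?_; x∈p∪q⁻; x∈p∪q⁺; p⊆p∪q; q⊆p∪q; x∈⁅x⁆; x∈⁅y⁆⇒x≡y; ∉⊥; ⊆-refl; ⊆-trans)
open import Data.Fin.Subset.Induction using (⊃-wellFounded)
open import Induction.WellFounded using (Acc; acc)
open import Data.Product using (∃; ∃₂; ∃-syntax; _×_; _,_; proj₂)
open import Data.Sum using (_⊎_; inj₁; inj₂; [_,_]; map₂)
open import Data.Empty using (⊥-elim)
open import Relation.Nullary using (¬_; Dec; yes; no)
open import Relation.Nullary.Decidable using (_×-dec_; ¬?)
open import Relation.Binary.PropositionalEquality using (_≡_; _≢_; refl)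
open import Function.Bundles using (Equivalence)

module _ {n : ℕ} where

  x∈p∪⁅y⁆⁻ : ∀ {x y} (p : Subset n) → x ∈ p ∪ ⁅ y ⁆ → x ∈ p ⊎ x ≡ y
  x∈p∪⁅y⁆⁻ {y = y} p x∈ = map₂ (x∈⁅y⁆⇒x≡y y) (x∈p∪q⁻ p ⁅ y ⁆ x∈)

  y∈p∪⁅y⁆ : ∀ (p : Subset n) y → y ∈ p ∪ ⁅ y ⁆
  y∈p∪⁅y⁆ p y = q⊆p∪q p ⁅ y ⁆ (x∈⁅x⁆ y)

  Disjoint : Subset n → Subset n → Set
  Disjoint D S = ∀ {x} → x ∈ D → x ∉ S

  Disjoint-sym : ∀ {D S} → Disjoint D S → Disjoint S D
  Disjoint-sym D#S x∈S x∈D = D#S x∈D x∈S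

  Disjoint-addʳ : ∀ {D S v} → v ∉ D → Disjoint D S → Disjoint D (S ∪ ⁅ v ⁆)
  Disjoint-addʳ {S = S} v∉D D#S x∈D x∈S∪v with x∈p∪⁅y⁆⁻ S x∈S∪v
  ... | inj₁ x∈S = D#S x∈D x∈S
  ... | inj₂ refl = v∉D x∈D

  Disjoint-addˡ : ∀ {D S v} → v ∉ S → Disjoint D S → Disjoint (D ∪ ⁅ v ⁆) S
  Disjoint-addˡ v∉S D#S = Disjoint-sym (Disjoint-addʳ v∉S (Disjoint-sym D#S))

  Free : Subset n → Subset n → Fin n → Set
  Free D S w = w ∉ D × w ∉ S

  free? : ∀ D S → Dec (∃ (Free D S))
  free? D S = any? λ w → ¬? (w ∈? D) ×-dec ¬? (w ∈? S)

  ¬free⇒full : ∀ {D S} → ¬ ∃ (Free D S) → ∀ v → v ∈ D ⊎ v ∈ S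
  ¬free⇒full {D} {S} noFree v with v ∈? D | v ∈? S
  ... | yes v∈D | _       = inj₁ v∈D
  ... | no _    | yes v∈S = inj₂ v∈S
  ... | no v∉D  | no v∉S  = ⊥-elim (noFree (v , v∉D , v∉S))

  ∪-⊂ : ∀ {D S D′ S′ w} → D ⊆ D′ → S ⊆ S′ → w ∈ D′ ∪ S′ → Free D S w →
        D ∪ S ⊂ D′ ∪ S′
  ∪-⊂ {D} {S} D⊆D′ S⊆S′ w∈ (w∉D , w∉S) =
    (λ x∈ → x∈p∪q⁺ (Data.Sum.map D⊆D′ S⊆S′ (x∈p∪q⁻ D S x∈))) ,
    _ , w∈ , λ w∈D∪S → [ w∉D , w∉S ] (x∈p∪q⁻ D S w∈D∪S)

  ⊂-addˡ : ∀ {D S w} → Free D S w → D ∪ S ⊂ (D ∪ ⁅ w ⁆) ∪ S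
  ⊂-addˡ {D} {S} {w} = ∪-⊂ (p⊆p∪q ⁅ w ⁆) ⊆-refl (p⊆p∪q S (y∈p∪⁅y⁆ D w))

  ⊂-addʳ : ∀ {D S w} → Free D S w → D ∪ S ⊂ D ∪ (S ∪ ⁅ w ⁆)
  ⊂-addʳ {D} {S} {w} = ∪-⊂ ⊆-refl (p⊆p∪q ⁅ w ⁆) (q⊆p∪q D _ (y∈p∪⁅y⁆ S w))

  module _ {P : Subset n → Subset n → Set} where

    completion : ∀ {p D S} → StallerForces P p D S → Disjoint D S →
                 ∃₂ λ D′ S′ → D ⊆ D′ × S ⊆ S′ × Disjoint D′ S′ × P D′ S′
    completion (done _ won) D#S = _ , _ , ⊆-refl , ⊆-refl , D#S , won
    completion (sMove v v∉D _ t) D#S with completion t (Disjoint-addʳ v∉D D#S)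
    ... | D′ , S′ , D⊆ , S∪v⊆ , D′#S′ , won =
      D′ , S′ , D⊆ , ⊆-trans (p⊆p∪q ⁅ v ⁆) S∪v⊆ , D′#S′ , won
    completion (dMove (v , v∉D , v∉S) t) D#S
      with completion (t v v∉D v∉S) (Disjoint-addˡ v∉S D#S)
    ... | D′ , S′ , D∪v⊆ , S⊆ , D′#S′ , won =
      D′ , S′ , ⊆-trans (p⊆p∪q ⁅ v ⁆) D∪v⊆ , S⊆ , D′#S′ , won

    answer : ∀ {D S b} → StallerForces P dominator D S → Free D S b →
             StallerForces P staller (D ∪ ⁅ b ⁆) S
    answer {b = b} (done full _) (b∉D , b∉S) = ⊥-elim ([ b∉D , b∉S ] (full b))
    answer (dMove _ t) (b∉D , b∉S) = t _ b∉D b∉S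

module Transfer {n₁ n : ℕ} (ι : Fin n₁ → Fin n) (ι-inj : ∀ {a b} → ι a ≡ ι b → a ≡ b)
  {P₁ : Subset n₁ → Subset n₁ → Set} {Q : Subset n → Subset n → Set}
  (outcome : ∀ {D S D₁ S₁} → Disjoint D₁ S₁ → P₁ D₁ S₁ →
             (∀ {b} → ι b ∈ D → b ∈ D₁) → Q D S)
  where

  record Simulates (D S : Subset n) (D₁ S₁ : Subset n₁) : Set where
    field
      disjoint   : Disjoint D₁ S₁
      dominator⁺ : ∀ {b} → b ∈ D₁ → ι b ∈ D
      dominator⁻ : ∀ {b} → ι b ∈ D → b ∈ D₁
      staller⁺   : ∀ {b} → b ∈ S₁ → ι b ∈ S
  open Simulates

  simulates-start : Simulates ⊥ ⊥ ⊥ ⊥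
  simulates-start = record
    { disjoint   = λ x∈⊥ _ → ∉⊥ x∈⊥
    ; dominator⁺ = λ b∈⊥ → ⊥-elim (∉⊥ b∈⊥)
    ; dominator⁻ = λ ιb∈⊥ → ⊥-elim (∉⊥ ιb∈⊥)
    ; staller⁺   = λ b∈⊥ → ⊥-elim (∉⊥ b∈⊥)
    }

  free-preimage : ∀ {D S D₁ S₁ b} → Simulates D S D₁ S₁ → Free D S (ι b) →
                  Free D₁ S₁ b
  free-preimage sim (ιb∉D , ιb∉S) =
    (λ b∈D₁ → ιb∉D (dominator⁺ sim b∈D₁)) , (λ b∈S₁ → ιb∉S (staller⁺ sim b∈S₁))

  simulates-staller-free : ∀ {D S D₁ S₁ w} → Simulates D S D₁ S₁ →
                           Simulates D (S ∪ ⁅ w ⁆) D₁ S₁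
  simulates-staller-free {w = w} sim = record
    { disjoint   = disjoint sim
    ; dominator⁺ = dominator⁺ sim
    ; dominator⁻ = dominator⁻ sim
    ; staller⁺   = λ b∈S₁ → p⊆p∪q ⁅ w ⁆ (staller⁺ sim b∈S₁)
    }

  simulates-staller : ∀ {D S D₁ S₁ v} → v ∉ D₁ → ι v ∈ S → Simulates D S D₁ S₁ →
                      Simulates D S D₁ (S₁ ∪ ⁅ v ⁆)
  simulates-staller {S = S} {S₁ = S₁} {v} v∉D₁ ιv∈S sim = record
    { disjoint   = Disjoint-addʳ v∉D₁ (disjoint sim)
    ; dominator⁺ = dominator⁺ sim
    ; dominator⁻ = dominator⁻ sim
    ; staller⁺   = staller⁺′
    }
    where
      staller⁺′ : ∀ {b} → b ∈ S₁ ∪ ⁅ v ⁆ → ι b ∈ S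
      staller⁺′ b∈ with x∈p∪⁅y⁆⁻ S₁ b∈
      ... | inj₁ b∈S₁ = staller⁺ sim b∈S₁
      ... | inj₂ refl = ιv∈S

  simulates-dominator : ∀ {D S D₁ S₁ b} → b ∉ S₁ → Simulates D S D₁ S₁ →
                        Simulates (D ∪ ⁅ ι b ⁆) S (D₁ ∪ ⁅ b ⁆) S₁
  simulates-dominator {D} {S} {D₁} {S₁} {b} b∉S₁ sim = record
    { disjoint   = Disjoint-addˡ b∉S₁ (disjoint sim)
    ; dominator⁺ = dominator⁺′
    ; dominator⁻ = dominator⁻′
    ; staller⁺   = staller⁺ sim
    }
    where
      dominator⁺′ : ∀ {c} → c ∈ D₁ ∪ ⁅ b ⁆ → ι c ∈ D ∪ ⁅ ι b ⁆
      dominator⁺′ c∈ with x∈p∪⁅y⁆⁻ D₁ c∈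
      ... | inj₁ c∈D₁ = p⊆p∪q ⁅ ι b ⁆ (dominator⁺ sim c∈D₁)
      ... | inj₂ refl = y∈p∪⁅y⁆ D (ι b)

      dominator⁻′ : ∀ {c} → ι c ∈ D ∪ ⁅ ι b ⁆ → c ∈ D₁ ∪ ⁅ b ⁆
      dominator⁻′ ιc∈ with x∈p∪⁅y⁆⁻ D ιc∈
      ... | inj₁ ιc∈D = p⊆p∪q ⁅ b ⁆ (dominator⁻ sim ιc∈D)
      ... | inj₂ ιc≡ιb with ι-inj ιc≡ιb
      ...   | refl = y∈p∪⁅y⁆ D₁ b

  simulates-dominator-outside : ∀ {D S D₁ S₁ w} → (∀ b → ι b ≢ w) →
                                Simulates D S D₁ S₁ → Simulates (D ∪ ⁅ w ⁆) S D₁ S₁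
  simulates-dominator-outside {D} {D₁ = D₁} {w = w} w∉ι sim = record
    { disjoint   = disjoint sim
    ; dominator⁺ = λ c∈D₁ → p⊆p∪q ⁅ w ⁆ (dominator⁺ sim c∈D₁)
    ; dominator⁻ = dominator⁻′
    ; staller⁺   = staller⁺ sim
    }
    where
      dominator⁻′ : ∀ {c} → ι c ∈ D ∪ ⁅ w ⁆ → c ∈ D₁
      dominator⁻′ {c} ιc∈ with x∈p∪⁅y⁆⁻ D ιc∈
      ... | inj₁ ιc∈D = dominator⁻ sim ιc∈D
      ... | inj₂ ιc≡w = ⊥-elim (w∉ι c ιc≡w)

  finish : ∀ {p q D S D₁ S₁} → Simulates D S D₁ S₁ → StallerForces P₁ p D₁ S₁ →
           ¬ ∃ (Free D S) → StallerForces Q q D S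
  finish sim t noFree with completion t (disjoint sim)
  ... | _ , _ , D₁⊆ , _ , D′#S′ , won =
    done (¬free⇒full noFree) (outcome D′#S′ won (λ ιb∈D → D₁⊆ (dominator⁻ sim ιb∈D)))

  mutual
    dominatorTurn : ∀ {D S D₁ S₁} → Acc _⊃_ (D ∪ S) → Simulates D S D₁ S₁ →
                    StallerForces P₁ dominator D₁ S₁ → StallerForces Q dominator D S
    dominatorTurn {D} {S} rec sim t with free? D S
    ... | no noFree = finish sim t noFree
    ... | yes someFree = dMove someFree λ w w∉D w∉S →
                           afterDominator rec sim t (w∉D , w∉S)

    afterDominator : ∀ {D S D₁ S₁ w} → Acc _⊃_ (D ∪ S) → Simulates D S D₁ S₁ →
                     StallerForces P₁ dominator D₁ S₁ → Free D S w →
                     StallerForces Q staller (D ∪ ⁅ w ⁆) S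
    afterDominator {w = w} (acc rs) sim t w-free with any? (λ b → ι b ≟ w)
    ... | yes (b , refl) =
      let b-free = free-preimage sim w-free
      in stallerTurn (rs (⊂-addˡ w-free)) (simulates-dominator (proj₂ b-free) sim)
                     (answer t b-free)
    ... | no w∉ι =
      stallerTurn (rs (⊂-addˡ w-free))
                  (simulates-dominator-outside (λ b ιb≡w → w∉ι (b , ιb≡w)) sim) t

    stallerTurn : ∀ {p D S D₁ S₁} → Acc _⊃_ (D ∪ S) → Simulates D S D₁ S₁ →
                  StallerForces P₁ p D₁ S₁ → StallerForces Q staller D S
    stallerTurn {D = D} {S} rec sim (sMove v v∉D₁ _ t) with ι v ∈? S
    -- ι v may have been taken by an earlier arbitrary move of Staller.
    ... | yes ιv∈S = stallerTurn rec (simulates-staller v∉D₁ ιv∈S sim) t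
    ... | no ιv∉S =
      stallerPlays rec (ιv∉D , ιv∉S)
        (simulates-staller v∉D₁ (y∈p∪⁅y⁆ S (ι v)) (simulates-staller-free sim)) t
      where
        ιv∉D : ι v ∉ D
        ιv∉D ιv∈D = v∉D₁ (dominator⁻ sim ιv∈D)
    stallerTurn rec sim (done full won) = stallerFreeMove rec sim (done full won)
    stallerTurn rec sim (dMove someFree t) = stallerFreeMove rec sim (dMove someFree t)

    stallerFreeMove : ∀ {D S D₁ S₁} → Acc _⊃_ (D ∪ S) → Simulates D S D₁ S₁ →
                      StallerForces P₁ dominator D₁ S₁ → StallerForces Q staller D S
    stallerFreeMove {D} {S} rec sim t with free? D S
    ... | no noFree = finish sim t noFree
    ... | yes (w , w-free) = stallerPlays rec w-free (simulates-staller-free sim) t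

    stallerPlays : ∀ {D S D₁ S₁ w} → Acc _⊃_ (D ∪ S) → Free D S w →
                   Simulates D (S ∪ ⁅ w ⁆) D₁ S₁ → StallerForces P₁ dominator D₁ S₁ →
                   StallerForces Q staller D S
    stallerPlays {w = w} (acc rs) w-free@(w∉D , w∉S) sim t =
      sMove w w∉D w∉S (dominatorTurn (rs (⊂-addʳ w-free)) sim t)

  transfer : ∀ p → StallerForces P₁ p ⊥ ⊥ → StallerForces Q p ⊥ ⊥
  transfer dominator = dominatorTurn (⊃-wellFounded _) simulates-start
  transfer staller   = stallerTurn (⊃-wellFounded _) simulates-start

module _ {n n₁ n₂} {G : Graph n} {G₁ : Graph n₁} {G₂ : Graph n₂}
         (A : Amalgamation G G₁ G₂) where

  onlyInG₁-neighbour : ∀ {v u} → OnlyInG₁ A v → Adj G (ι₁ A v) u →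
                       ∃[ b ] (ι₁ A b ≡ u × Adj G₁ v b)
  onlyInG₁-neighbour {v} {u} v∉G₂ vu with Equivalence.to (adj A (ι₁ A v) u) vu
  ... | inj₂ (a , _ , ι₂a≡ι₁v , _) = ⊥-elim (v∉G₂ (a , ι₂a≡ι₁v))
  ... | inj₁ (a , b , ι₁a≡ι₁v , ι₁b≡u , ab) with ι₁-inj A ι₁a≡ι₁v
  ...   | refl = b , ι₁b≡u , ab

  isolated⇒¬totalDominating : ∀ {D D₁ S₁} → Disjoint D₁ S₁ →
                              ∃[ v ] (OnlyInG₁ A v × Isolates G₁ S₁ v) →
                              (∀ {b} → ι₁ A b ∈ D → b ∈ D₁) →
                              ¬ IsTotalDominating G D
  isolated⇒¬totalDominating D₁#S₁ (v , v∉G₂ , isolated) dominator⁻ td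
    with td (ι₁ A v)
  ... | u , vu , u∈D with onlyInG₁-neighbour v∉G₂ vu
  ...   | b , refl , vb = D₁#S₁ (dominator⁻ u∈D) (isolated b vb)

lemma4p1 : ∀ {n n₁ n₂} (G : Graph n) (G₁ : Graph n₁) (G₂ : Graph n₂)
             (A : Amalgamation G G₁ G₂) (p : Player) →
             StallerForces (λ D S → ∃[ v ] (OnlyInG₁ A v × Isolates G₁ S v)) p ⊥ ⊥ →
             StallerWins G p
lemma4p1 G G₁ G₂ A =
  Transfer.transfer (ι₁ A) (ι₁-inj A) (isolated⇒¬totalDominating A)
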